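{- For every positive integer $d$, the graph $\mathbb{L}^d_+$ has homogeneous growth with respect to the origin.
   Context: $\mathbb L^d$ is the graph with vertex set $\mathbb Z^d$ in which $x,y$ are adjacent iff $\sum_{i=1}^d|x_i-y_i|=1$. $\mathbb L^d_+$ is the subgraph induced by the vertices with all coordinates $\ge0$; the origin is the all-zero vertex. For a vertex $g_0$, let $S_n$ be the set of vertices at combinatorial distance exactly $n$ from $g_0$ and $s_n=|S_n|$; for $T\subseteq S_n$, $T^*$ is the set of vertices of $S_{n+1}$ adjacent to some vertex of $T$. A graph has homogeneous growth with respect to $g_0$ if there is $r\ge0$ such that for every $n\ge r$ and every non-empty $T\subseteq S_n$, $\frac{|T^*|}{|T|}\ge\frac{s_{n+1}}{s_n}\ge1$. -}

module Defs where

open import Data.Nat using (ℕ; zero; suc; _+_; _*_; _≤_; _<_; ∣_-_∣)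
open import Data.Vec using (Vec; replicate; zipWith; sum)
open import Data.List using (List; length; [])
open import Data.List.Membership.Propositional using (_∈_)
open import Data.List.Relation.Unary.All using (All)
open import Data.List.Relation.Unary.Unique.Propositional using (Unique)
open import Data.Product using (Σ; _×_; ∃-syntax)
open import Relation.Binary.PropositionalEquality using (_≡_)
open import Relation.Nullary using (¬_)
open import Level using (0ℓ)

-- Vertices of 𝕃^d_+ : points of ℤ^d with all coordinates ≥ 0, i.e. ℕ^d.
Vertex : ℕ → Set
Vertex d = Vec ℕ d

origin : (d : ℕ) → Vertex d
origin d = replicate d 0

-- Adjacency of 𝕃^d (restricted to ℕ^d, i.e. the induced subgraph 𝕃^d_+):
-- Σ_i |x_i - y_i| = 1.
Adj : {d : ℕ} → Vertex d → Vertex d → Set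
Adj x y = sum (zipWith ∣_-_∣ x y) ≡ 1

data Walk {d : ℕ} : Vertex d → Vertex d → ℕ → Set where
  here : ∀ {x} → Walk x x 0
  step : ∀ {x y z k} → Adj x y → Walk y z k → Walk x z (suc k)

Dist : {d : ℕ} → Vertex d → Vertex d → ℕ → Set
Dist x y n = Walk x y n × (∀ m → m < n → ¬ Walk x y m)

Sphere : {d : ℕ} → Vertex d → ℕ → Vertex d → Set
Sphere g₀ n x = Dist g₀ x n

HasCard : {d : ℕ} → (Vertex d → Set) → ℕ → Set
HasCard {d} P k =
  Σ (List (Vertex d)) λ xs →
    Unique xs × (∀ x → (P x → x ∈ xs) × (x ∈ xs → P x)) × length xs ≡ k

Star : {d : ℕ} → Vertex d → ℕ → List (Vertex d) → Vertex d → Set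
Star g₀ n T y = Sphere g₀ (suc n) y × ∃[ x ] (x ∈ T × Adj x y)

-- The inequality
-- |T*|/|T| ≥ s_{n+1}/s_n is written cross-multiplied: s_{n+1}·|T| ≤ |T*|·s_n
-- (with |T| > 0 and s_n > 0, so both ratios are defined).
-- A finite subset T ⊆ S_n is a duplicate-free nonempty list of vertices of S_n.
HomogeneousGrowth : (d : ℕ) → Vertex d → Set
HomogeneousGrowth d g₀ =
  ∃[ r ] ∀ n → r ≤ n →
    Σ ℕ λ sₙ → Σ ℕ λ sₙ₊₁ →
      HasCard (Sphere g₀ n) sₙ × HasCard (Sphere g₀ (suc n)) sₙ₊₁ ×
      0 < sₙ × sₙ ≤ sₙ₊₁ ×
      (∀ (T : List (Vertex d)) → Unique T → ¬ (T ≡ []) → All (Sphere g₀ n) T →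
        Σ ℕ λ t* → HasCard (Star g₀ n T) t* × sₙ₊₁ * length T ≤ t* * sₙ)

module Submission where

-- The n-sphere about the origin of ℕᵈ is {x ∣ Σᵢ xᵢ = n}, and the neighbours of x on the next
-- sphere are the x + eᵢ. Give the pair (x, x + eᵢ) the weight (x + eᵢ)ᵢ = xᵢ + 1. Each x on the
-- n-sphere then sends total weight Σᵢ (xᵢ + 1) = d + n into T*, while each y on the (n+1)-sphere
-- receives at most Σᵢ yᵢ = n + 1, with equality when T is the whole n-sphere. Double counting
-- gives |T| (d + n) ≤ |T*| (n + 1) and s_{n+1} (n + 1) = s_n (d + n), i.e.
-- |T*| / |T| ≥ (d + n) / (n + 1) = s_{n+1} / s_n ≥ 1, already from r = 0.

open import Defs
import Algebra.Properties.CommutativeMonoid.Sum as FinSum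
open import Data.Fin using (Fin; zero; suc)
open import Data.List using (List; []; _∷_; length; map; _++_; filter)
open import Data.List.Membership.Propositional using (_∈_; find; lose)
open import Data.List.Membership.Propositional.Properties
  using (∈-map⁺; ∈-map⁻; ∈-++⁺ˡ; ∈-++⁺ʳ; ∈-filter⁺; ∈-filter⁻; ∈-length)
open import Data.List.Relation.Unary.All as All using (All; []; _∷_)
import Data.List.Relation.Unary.All.Properties as All
open import Data.List.Relation.Unary.AllPairs using ([]; _∷_)
open import Data.List.Relation.Unary.Any using (here; there; any?)
open import Data.List.Relation.Unary.Unique.Propositional using (Unique)
import Data.List.Relation.Unary.Unique.Propositional.Properties as Unique
open import Data.Nat
  using (ℕ; zero; suc; _+_; _*_; _≤_; _<_; z≤n; s≤s; pred; ∣_-_∣; _≟_; NonZero)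
open import Data.Nat.Properties
open import Data.Product using (_×_; _,_; proj₁)
open import Data.Vec using (Vec; []; _∷_; zipWith; sum; lookup; updateAt)
open import Data.Vec.Properties
  using (≡-dec; ∷-injectiveʳ; updateAt-updateAt; updateAt-updateAt-local; updateAt-id)
open import Function.Base using (id; _∘_; flip)
open import Function.Bundles using (_⇔_; mk⇔; module Equivalence)
open import Function.Definitions using (Injective)
open import Relation.Binary.Definitions using (DecidableEquality)
open import Relation.Binary.PropositionalEquality
open import Relation.Nullary using (¬_; Dec; yes; no; contradiction)

open FinSum +-0-commutativeMonoid using (sum-syntax; ∑-distrib-+; sum-cong-≗; sum-replicate-zero)
import Algebra.Properties.CommutativeSemigroup as CommutativeSemigroupProperties
open CommutativeSemigroupProperties +-commutativeSemigroup
  using () renaming (interchange to +-interchange; x∙yz≈y∙xz to +-left-comm)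
module *-Properties = CommutativeSemigroupProperties *-commutativeSemigroup
open Equivalence using (to; from)

∑ₗ : {A : Set} → List A → (A → ℕ) → ℕ
∑ₗ []       f = 0
∑ₗ (x ∷ xs) f = f x + ∑ₗ xs f

infixl 10 ∑ₗ
syntax ∑ₗ xs (λ x → e) = ∑[ x ∈ xs ] e

module _ {A : Set} where

  ∑ₗ-monoᴬ : ∀ {xs : List A} {f g : A → ℕ} → All (λ x → f x ≤ g x) xs → ∑ₗ xs f ≤ ∑ₗ xs g
  ∑ₗ-monoᴬ []       = z≤n
  ∑ₗ-monoᴬ (p ∷ ps) = +-mono-≤ p (∑ₗ-monoᴬ ps)

  ∑ₗ-const : ∀ (xs : List A) c → ∑[ x ∈ xs ] c ≡ length xs * c
  ∑ₗ-const []       c = refl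
  ∑ₗ-const (x ∷ xs) c = cong (c +_) (∑ₗ-const xs c)

  ∑ₗ-zero : ∀ {xs : List A} {f : A → ℕ} → All (λ x → f x ≡ 0) xs → ∑ₗ xs f ≡ 0
  ∑ₗ-zero []       = refl
  ∑ₗ-zero (p ∷ ps) = cong₂ _+_ p (∑ₗ-zero ps)

  ∑ₗ-*ʳ : ∀ (xs : List A) (f : A → ℕ) c → ∑[ x ∈ xs ] (f x * c) ≡ ∑ₗ xs f * c
  ∑ₗ-*ʳ []       f c = refl
  ∑ₗ-*ʳ (x ∷ xs) f c = trans (cong (f x * c +_) (∑ₗ-*ʳ xs f c)) (sym (*-distribʳ-+ c (f x) (∑ₗ xs f)))

  ∑ₗ-distrib-+ : ∀ (xs : List A) (f g : A → ℕ) → ∑[ x ∈ xs ] (f x + g x) ≡ ∑ₗ xs f + ∑ₗ xs g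
  ∑ₗ-distrib-+ []       f g = refl
  ∑ₗ-distrib-+ (x ∷ xs) f g =
    trans (cong (f x + g x +_) (∑ₗ-distrib-+ xs f g)) (+-interchange (f x) (g x) _ _)

  ∈⇒≤∑ₗ : ∀ {xs : List A} {z} (f : A → ℕ) → z ∈ xs → f z ≤ ∑ₗ xs f
  ∈⇒≤∑ₗ f (here refl) = m≤m+n _ _
  ∈⇒≤∑ₗ f (there z∈xs) = ≤-trans (∈⇒≤∑ₗ f z∈xs) (m≤n+m _ _)

  ∑ₗ-∑-comm : ∀ (xs : List A) d (f : A → Fin d → ℕ) →
    ∑[ x ∈ xs ] ∑[ i < d ] f x i ≡ ∑[ i < d ] ∑[ x ∈ xs ] f x i
  ∑ₗ-∑-comm []       d f = sym (sum-replicate-zero d)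
  ∑ₗ-∑-comm (x ∷ xs) d f =
    trans (cong (∑[ i < d ] f x i +_) (∑ₗ-∑-comm xs d f)) (sym (∑-distrib-+ (f x) _))

∑ₗ-comm : ∀ {A B : Set} (xs : List A) (ys : List B) (f : A → B → ℕ) →
  ∑[ x ∈ xs ] ∑[ y ∈ ys ] f x y ≡ ∑[ y ∈ ys ] ∑[ x ∈ xs ] f x y
∑ₗ-comm []       ys f = sym (∑ₗ-zero {xs = ys} (All.tabulate (λ _ → refl)))
∑ₗ-comm (x ∷ xs) ys f =
  trans (cong (∑ₗ ys (f x) +_) (∑ₗ-comm xs ys f)) (sym (∑ₗ-distrib-+ ys (f x) _))

double-counting : ∀ {A B : Set} {xs : List A} {ys : List B} {r c} (w : A → B → ℕ) →
  All (λ x → r ≤ ∑[ y ∈ ys ] w x y) xs → All (λ y → ∑[ x ∈ xs ] w x y ≤ c) ys →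
  length xs * r ≤ length ys * c
double-counting {xs = xs} {ys} {r} {c} w rows columns = begin
  length xs * r                  ≡⟨ ∑ₗ-const xs r ⟨
  ∑[ x ∈ xs ] r                  ≤⟨ ∑ₗ-monoᴬ rows ⟩
  ∑[ x ∈ xs ] ∑[ y ∈ ys ] w x y  ≡⟨ ∑ₗ-comm xs ys w ⟩
  ∑[ y ∈ ys ] ∑[ x ∈ xs ] w x y  ≤⟨ ∑ₗ-monoᴬ columns ⟩
  ∑[ y ∈ ys ] c                  ≡⟨ ∑ₗ-const ys c ⟩
  length ys * c                  ∎
  where open ≤-Reasoning

∑-mono : ∀ d {f g : Fin d → ℕ} → (∀ i → f i ≤ g i) → ∑[ i < d ] f i ≤ ∑[ i < d ] g i
∑-mono zero    f≤g = z≤n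
∑-mono (suc d) f≤g = +-mono-≤ (f≤g zero) (∑-mono d (f≤g ∘ suc))

∑-lookup : ∀ {d} (x : Vec ℕ d) → ∑[ i < d ] lookup x i ≡ sum x
∑-lookup []      = refl
∑-lookup (a ∷ x) = cong (a +_) (∑-lookup x)

-- Cross-multiplied forms of  s / s′ ≤ p / q ≤ 1  and  s′ / s ≤ q / p ≤ t′ / t.
ratio-≤⇒≤ : ∀ s s′ {p q} .{{_ : NonZero p}} → s * q ≤ s′ * p → p ≤ q → s ≤ s′
ratio-≤⇒≤ s s′ {p} sq≤s′p p≤q = *-cancelʳ-≤ s s′ p (≤-trans (*-monoʳ-≤ s p≤q) sq≤s′p)

ratio-≤-trans : ∀ s s′ t t′ {p q} .{{_ : NonZero p}} → s′ * p ≤ s * q → t * q ≤ t′ * p → s′ * t ≤ t′ * s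
ratio-≤-trans s s′ t t′ {p} {q} s′p≤sq tq≤t′p = *-cancelʳ-≤ (s′ * t) (t′ * s) p (begin
  s′ * t * p    ≡⟨ *-Properties.xy∙z≈xz∙y s′ t p ⟩
  s′ * p * t    ≤⟨ *-monoˡ-≤ t s′p≤sq ⟩
  s * q * t     ≡⟨ *-Properties.xy∙z≈x∙zy s q t ⟩
  s * (t * q)   ≤⟨ *-monoʳ-≤ s tq≤t′p ⟩
  s * (t′ * p)  ≡⟨ *-Properties.x∙yz≈yx∙z s t′ p ⟩
  t′ * s * p    ∎)
  where open ≤-Reasoning

module Indicator {A : Set} (_≟ᴬ_ : DecidableEquality A) where

  δ : A → A → ℕ
  δ x y with x ≟ᴬ y
  ... | yes _ = 1
  ... | no  _ = 0

  δ-≡ : ∀ {x y} → x ≡ y → δ x y ≡ 1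
  δ-≡ {x} {y} x≡y with x ≟ᴬ y
  ... | yes _   = refl
  ... | no x≢y = contradiction x≡y x≢y

  δ-≢ : ∀ {x y} → x ≢ y → δ x y ≡ 0
  δ-≢ {x} {y} x≢y with x ≟ᴬ y
  ... | yes x≡y = contradiction x≡y x≢y
  ... | no _    = refl

  ∑-δ-* : ∀ {ys z} (c : A → ℕ) → Unique ys → z ∈ ys → ∑[ y ∈ ys ] (δ z y * c y) ≡ c z
  ∑-δ-* {_ ∷ ys} {z} c (z≢ys ∷ _) (here refl) = begin
    δ z z * c z + ∑[ y ∈ ys ] (δ z y * c y)  ≡⟨ cong₂ _+_ (cong (_* c z) (δ-≡ refl)) rest≡0 ⟩
    1 * c z + 0                              ≡⟨ trans (+-identityʳ _) (*-identityˡ _) ⟩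
    c z                                      ∎
    where
    open ≡-Reasoning
    rest≡0 : ∑[ y ∈ ys ] (δ z y * c y) ≡ 0
    rest≡0 = ∑ₗ-zero (All.map (λ z≢y → cong (_* c _) (δ-≢ z≢y)) z≢ys)
  ∑-δ-* c (x≢ys ∷ unique) (there z∈ys) =
    cong₂ _+_ (cong (_* c _) (δ-≢ (λ z≡x → All.lookup x≢ys z∈ys (sym z≡x))))
              (∑-δ-* c unique z∈ys)

  ∑-δ-injective-≤1 : ∀ {f : A → A} {xs y} → Injective _≡_ _≡_ f → Unique xs →
    ∑[ x ∈ xs ] δ (f x) y ≤ 1
  ∑-δ-injective-≤1 f-inj [] = z≤n
  ∑-δ-injective-≤1 {f} {x ∷ xs} {y} f-inj (x≢xs ∷ unique) with f x ≟ᴬ y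
  ... | yes fx≡y = ≤-reflexive (cong suc (∑ₗ-zero (All.map
          (λ x≢x′ → δ-≢ (λ fx′≡y → x≢x′ (f-inj (trans fx≡y (sym fx′≡y))))) x≢xs)))
  ... | no _     = ∑-δ-injective-≤1 f-inj unique

increment : ∀ {d} → Fin d → Vertex d → Vertex d
increment i x = updateAt x i suc

sum-increment : ∀ {d} i (x : Vertex d) → sum (increment i x) ≡ suc (sum x)
sum-increment zero    (a ∷ x) = refl
sum-increment (suc i) (a ∷ x) = trans (cong (a +_) (sum-increment i x)) (+-suc a (sum x))

sum-increment-≡ : ∀ {d n} i (x : Vertex d) → sum x ≡ n → sum (increment i x) ≡ suc n
sum-increment-≡ i x sum≡n = trans (sum-increment i x) (cong suc sum≡n)

increment-injective : ∀ {d} (i : Fin d) → Injective _≡_ _≡_ (increment i)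
increment-injective i {x} {y} eq = begin
  x                                   ≡⟨ updateAt-id i x ⟨
  updateAt x i id                     ≡⟨ updateAt-updateAt i x ⟨
  updateAt (increment i x) i pred     ≡⟨ cong (λ v → updateAt v i pred) eq ⟩
  updateAt (increment i y) i pred     ≡⟨ updateAt-updateAt i y ⟩
  updateAt y i id                     ≡⟨ updateAt-id i y ⟩
  y                                   ∎
  where open ≡-Reasoning

increment-decrement : ∀ {d} i (y : Vertex d) {k} → lookup y i ≡ suc k →
  increment i (updateAt y i pred) ≡ y
increment-decrement i y yᵢ≡1+k =
  trans (updateAt-updateAt-local i y suc-pred-yᵢ) (updateAt-id i y)
  where
  suc-pred-yᵢ : suc (pred (lookup y i)) ≡ lookup y i
  suc-pred-yᵢ = trans (cong (λ (n : ℕ) → suc (pred n)) yᵢ≡1+k) (sym yᵢ≡1+k)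

sum-∣x-x∣ : ∀ {d} (x : Vertex d) → sum (zipWith ∣_-_∣ x x) ≡ 0
sum-∣x-x∣ []      = refl
sum-∣x-x∣ (a ∷ x) = cong₂ _+_ (∣n-n∣≡0 a) (sum-∣x-x∣ x)

adj-increment : ∀ {d} i (x : Vertex d) → Adj x (increment i x)
adj-increment zero    (a ∷ x) =
  cong₂ _+_ (trans (cong ∣ a -_∣ (+-comm 1 a)) (∣m-m+n∣≡n a 1)) (sum-∣x-x∣ x)
adj-increment (suc i) (a ∷ x) = cong₂ _+_ (∣n-n∣≡0 a) (adj-increment i x)

adj-sum-≤ : ∀ {d} {x y : Vertex d} → Adj x y → sum y ≤ sum x + 1
adj-sum-≤ {x = x} {y} adj = subst (λ t → sum y ≤ sum x + t) adj (sum-≤ x y)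
  where
  -- ∣-∣-triangle 0 a b : b ≤ a + ∣ a - b ∣, as ∣ 0 - m ∣ reduces to m.
  sum-≤ : ∀ {d} (x y : Vertex d) → sum y ≤ sum x + sum (zipWith ∣_-_∣ x y)
  sum-≤ []      []      = z≤n
  sum-≤ (a ∷ x) (b ∷ y) =
    ≤-trans (+-mono-≤ (∣-∣-triangle 0 a b) (sum-≤ x y)) (≤-reflexive (+-interchange a _ _ _))

walk-sum-≤ : ∀ {d} {x y : Vertex d} {k} → Walk x y k → sum y ≤ sum x + k
walk-sum-≤ here = ≤-reflexive (sym (+-identityʳ _))
walk-sum-≤ {x = x} {z} (step {y = y} {k = k} adj walk) = begin
  sum z            ≤⟨ walk-sum-≤ walk ⟩
  sum y + k        ≤⟨ +-monoˡ-≤ k (adj-sum-≤ {x = x} {y} adj) ⟩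
  sum x + 1 + k    ≡⟨ +-assoc (sum x) 1 k ⟩
  sum x + suc k    ∎
  where open ≤-Reasoning

_▷_ : ∀ {d} {x y z : Vertex d} {k} → Walk x y k → Adj y z → Walk x z (suc k)
here          ▷ adj = step adj here
step adj′ walk ▷ adj = step adj′ (walk ▷ adj)

walk-∷ : ∀ {d} a {x y : Vertex d} {k} → Walk x y k → Walk (a ∷ x) (a ∷ y) k
walk-∷ a here            = here
walk-∷ a (step adj walk) = step (trans (cong (_+ _) (∣n-n∣≡0 a)) adj) (walk-∷ a walk)

walk-from-origin : ∀ {d} (x : Vertex d) → Walk (origin d) x (sum x)
walk-from-origin []      = here
walk-from-origin (a ∷ x) = climb a
  where
  climb : ∀ a → Walk (origin _) (a ∷ x) (a + sum x)
  climb zero    = walk-∷ 0 (walk-from-origin x)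
  climb (suc a) = climb a ▷ adj-increment zero (a ∷ x)

sum-origin : ∀ d → sum (origin d) ≡ 0
sum-origin zero    = refl
sum-origin (suc d) = sum-origin d

sum≤walk-length : ∀ {d} {x : Vertex d} {k} → Walk (origin d) x k → sum x ≤ k
sum≤walk-length {d} {x} {k} walk = subst (λ t → sum x ≤ t + k) (sum-origin d) (walk-sum-≤ walk)

sphere⇔sum : ∀ {d} {n} {x : Vertex d} → Sphere (origin d) n x ⇔ sum x ≡ n
sphere⇔sum {d} {n} {x} = mk⇔ sphere⇒sum sum⇒sphere
  where
  sphere⇒sum : Sphere (origin d) n x → sum x ≡ n
  sphere⇒sum (walk , no-shorter) =
    ≤-antisym (sum≤walk-length walk)
              (≮⇒≥ (λ x<n → no-shorter (sum x) x<n (walk-from-origin x)))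
  sum⇒sphere : sum x ≡ n → Sphere (origin d) n x
  sum⇒sphere refl = walk-from-origin x , λ m m<n walk → <⇒≱ m<n (sum≤walk-length walk)

∑-lookup-increment : ∀ {d} (x : Vertex d) → ∑[ i < d ] lookup (increment i x) i ≡ d + sum x
∑-lookup-increment []              = refl
∑-lookup-increment {suc d} (a ∷ x) =
  cong suc (trans (cong (a +_) (∑-lookup-increment x)) (+-left-comm a d (sum x)))

layer : (d n : ℕ) → List (Vertex d)
layer zero    zero    = [] ∷ []
layer zero    (suc n) = []
layer (suc d) zero    = map (0 ∷_) (layer d zero)
layer (suc d) (suc n) = map (0 ∷_) (layer d (suc n)) ++ map (increment zero) (layer (suc d) n)

layer-sums : ∀ d n → All (λ x → sum x ≡ n) (layer d n)
layer-sums zero    zero    = refl ∷ []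
layer-sums zero    (suc n) = []
layer-sums (suc d) zero    = All.map⁺ (layer-sums d zero)
layer-sums (suc d) (suc n) =
  All.++⁺ (All.map⁺ (layer-sums d (suc n)))
          (All.map⁺ (All.map (λ {x} → sum-increment-≡ zero x) (layer-sums (suc d) n)))

layer-complete : ∀ {d} (x : Vertex d) → x ∈ layer d (sum x)
layer-complete []      = here refl
layer-complete (a ∷ x) = climb a
  where
  0∷-∈ : ∀ {d} n {x : Vertex d} → x ∈ layer d n → (0 ∷ x) ∈ layer (suc d) n
  0∷-∈ zero    x∈ = ∈-map⁺ (0 ∷_) x∈
  0∷-∈ (suc n) x∈ = ∈-++⁺ˡ (∈-map⁺ (0 ∷_) x∈)
  climb : ∀ a → (a ∷ x) ∈ layer _ (a + sum x)
  climb zero    = 0∷-∈ (sum x) (layer-complete x)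
  climb (suc a) = ∈-++⁺ʳ _ (∈-map⁺ (increment zero) (climb a))

∈-layer⇔ : ∀ {d n} {x : Vertex d} → x ∈ layer d n ⇔ sum x ≡ n
∈-layer⇔ {d} {n} {x} = mk⇔ (All.lookup (layer-sums d n)) (λ { refl → layer-complete x })

increment-∈-layer : ∀ {d n} i (x : Vertex d) → sum x ≡ n → increment i x ∈ layer d (suc n)
increment-∈-layer i x sum≡n = from ∈-layer⇔ (sum-increment-≡ i x sum≡n)

layer-unique : ∀ d n → Unique (layer d n)
layer-unique zero    zero    = [] ∷ []
layer-unique zero    (suc n) = []
layer-unique (suc d) zero    = Unique.map⁺ ∷-injectiveʳ (layer-unique d zero)
layer-unique (suc d) (suc n) =
  Unique.++⁺ (Unique.map⁺ ∷-injectiveʳ (layer-unique d (suc n)))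
             (Unique.map⁺ (increment-injective zero) (layer-unique (suc d) n))
             disjoint
  where
  disjoint : ∀ {v} →
    ¬ (v ∈ map (0 ∷_) (layer d (suc n)) × v ∈ map (increment zero) (layer (suc d) n))
  disjoint (v∈₁ , v∈₂) with ∈-map⁻ (0 ∷_) v∈₁ | ∈-map⁻ (increment zero) v∈₂
  ... | _ , _ , refl | (_ ∷ _) , _ , ()

sphere-card : ∀ d n → HasCard (Sphere (origin d) n) (length (layer d n))
sphere-card d n =
  layer d n , layer-unique d n ,
  (λ x → from ∈-layer⇔ ∘ to sphere⇔sum , from sphere⇔sum ∘ to ∈-layer⇔) , refl

layer-nonempty : ∀ d n → 0 < length (layer (suc d) n)
layer-nonempty d n =
  ∈-length (from (∈-layer⇔ {x = n ∷ origin d}) (trans (cong (n +_) (sum-origin d)) (+-identityʳ n)))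

adj? : ∀ {d} (x y : Vertex d) → Dec (Adj x y)
adj? x y = sum (zipWith ∣_-_∣ x y) ≟ 1

star : ∀ {d} → List (Vertex d) → ℕ → List (Vertex d)
star {d} T n = filter (λ y → any? (λ x → adj? x y) T) (layer d (suc n))

∈-star⇔ : ∀ {d} {T : List (Vertex d)} {n y} → y ∈ star T n ⇔ Star (origin d) n T y
∈-star⇔ {d} {T} {n} {y} = mk⇔ ∈⇒Star Star⇒∈
  where
  ∈⇒Star : y ∈ star T n → Star (origin d) n T y
  ∈⇒Star y∈ with ∈-filter⁻ (λ y → any? (λ x → adj? x y) T) y∈
  ... | y∈layer , adjacent = from sphere⇔sum (All.lookup (layer-sums d (suc n)) y∈layer) , find adjacent
  Star⇒∈ : Star (origin d) n T y → y ∈ star T n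
  Star⇒∈ (y∈sphere , x , x∈T , adj) =
    ∈-filter⁺ (λ y → any? (λ x → adj? x y) T)
      (from ∈-layer⇔ (to sphere⇔sum y∈sphere)) (lose x∈T adj)

star-unique : ∀ {d} (T : List (Vertex d)) n → Unique (star T n)
star-unique {d} T n = Unique.filter⁺ (λ y → any? (λ x → adj? x y) T) (layer-unique d (suc n))

star-card : ∀ {d} (T : List (Vertex d)) n → HasCard (Star (origin d) n T) (length (star T n))
star-card T n = star T n , star-unique T n , (λ y → from ∈-star⇔ , to ∈-star⇔) , refl

module _ {d : ℕ} where

  open Indicator (≡-dec {n = d} _≟_)

  weight : Vertex d → Vertex d → ℕ
  weight x y = ∑[ i < d ] (δ (increment i x) y * lookup y i)

  weight-row : ∀ {ys : List (Vertex d)} {x} → Unique ys → (∀ i → increment i x ∈ ys) →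
    ∑[ y ∈ ys ] weight x y ≡ d + sum x
  weight-row {ys} {x} unique increments∈ = begin
    ∑[ y ∈ ys ] weight x y                                    ≡⟨ ∑ₗ-∑-comm ys d _ ⟩
    ∑[ i < d ] ∑[ y ∈ ys ] (δ (increment i x) y * lookup y i)
      ≡⟨ sum-cong-≗ (λ i → ∑-δ-* (λ y → lookup y i) unique (increments∈ i)) ⟩
    ∑[ i < d ] lookup (increment i x) i                       ≡⟨ ∑-lookup-increment x ⟩
    d + sum x                                                 ∎
    where open ≡-Reasoning

  ∑-weight-column : ∀ (xs : List (Vertex d)) y →
    ∑[ x ∈ xs ] weight x y ≡ ∑[ i < d ] (∑[ x ∈ xs ] δ (increment i x) y * lookup y i)
  ∑-weight-column xs y =
    trans (∑ₗ-∑-comm xs d _)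
          (sum-cong-≗ (λ i → ∑ₗ-*ʳ xs (λ x → δ (increment i x) y) (lookup y i)))

  weight-column-≤ : ∀ {xs : List (Vertex d)} {y} → Unique xs → ∑[ x ∈ xs ] weight x y ≤ sum y
  weight-column-≤ {xs} {y} unique = begin
    ∑[ x ∈ xs ] weight x y                                    ≡⟨ ∑-weight-column xs y ⟩
    ∑[ i < d ] (∑[ x ∈ xs ] δ (increment i x) y * lookup y i)
      ≤⟨ ∑-mono d (λ i → *-monoˡ-≤ (lookup y i) (∑-δ-injective-≤1 (increment-injective i) unique)) ⟩
    ∑[ i < d ] (1 * lookup y i)                               ≡⟨ sum-cong-≗ (λ i → *-identityˡ (lookup y i)) ⟩
    ∑[ i < d ] lookup y i                                     ≡⟨ ∑-lookup y ⟩
    sum y                                                     ∎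
    where open ≤-Reasoning

  weight-column-≥ : ∀ {xs : List (Vertex d)} {y} → (∀ z → suc (sum z) ≡ sum y → z ∈ xs) →
    sum y ≤ ∑[ x ∈ xs ] weight x y
  weight-column-≥ {xs} {y} predecessors∈ = begin
    sum y                                                     ≡⟨ ∑-lookup y ⟨
    ∑[ i < d ] lookup y i                                     ≤⟨ ∑-mono d coordinate-≤ ⟩
    ∑[ i < d ] (∑[ x ∈ xs ] δ (increment i x) y * lookup y i) ≡⟨ ∑-weight-column xs y ⟨
    ∑[ x ∈ xs ] weight x y                                    ∎
    where
    open ≤-Reasoning
    coordinate-≤ : ∀ i → lookup y i ≤ ∑[ x ∈ xs ] δ (increment i x) y * lookup y i
    coordinate-≤ i with lookup y i in yᵢ≡
    ... | zero  = z≤n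
    ... | suc k = begin
      suc k                                    ≡⟨ *-identityˡ (suc k) ⟨
      1 * suc k                                ≤⟨ *-monoˡ-≤ (suc k) predecessor-counted ⟩
      ∑[ x ∈ xs ] δ (increment i x) y * suc k  ∎
      where
      z : Vertex d
      z = updateAt y i pred
      z+eᵢ≡y : increment i z ≡ y
      z+eᵢ≡y = increment-decrement i y yᵢ≡
      z∈xs : z ∈ xs
      z∈xs = predecessors∈ z (trans (sym (sum-increment i z)) (cong sum z+eᵢ≡y))
      predecessor-counted : 1 ≤ ∑[ x ∈ xs ] δ (increment i x) y
      predecessor-counted =
        subst (_≤ ∑[ x ∈ xs ] δ (increment i x) y) (δ-≡ z+eᵢ≡y) (∈⇒≤∑ₗ (λ x → δ (increment i x) y) z∈xs)

  expansion-≤ : ∀ {n} {xs ys : List (Vertex d)} → Unique xs → Unique ys →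
    All (λ x → sum x ≡ n × (∀ i → increment i x ∈ ys)) xs → All (λ y → sum y ≡ suc n) ys →
    length xs * (d + n) ≤ length ys * suc n
  expansion-≤ xs-unique ys-unique xs-props ys-sums = double-counting weight
    (All.map (λ {x} (sum≡n , increments∈) → ≤-reflexive (sym
               (trans (weight-row {x = x} ys-unique increments∈) (cong (d +_) sum≡n)))) xs-props)
    (All.map (λ sum≡1+n → ≤-trans (weight-column-≤ xs-unique) (≤-reflexive sum≡1+n)) ys-sums)

  layer-expansion : ∀ n → length (layer d n) * (d + n) ≤ length (layer d (suc n)) * suc n
  layer-expansion n = expansion-≤ (layer-unique d n) (layer-unique d (suc n))
    (All.map (λ {x} sum≡n → sum≡n , λ i → increment-∈-layer i x sum≡n) (layer-sums d n))
    (layer-sums d (suc n))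

  layer-contraction : ∀ n → length (layer d (suc n)) * suc n ≤ length (layer d n) * (d + n)
  layer-contraction n = double-counting (flip weight)
    (All.map (λ {y} sum≡1+n → subst (_≤ ∑[ x ∈ layer d n ] weight x y) sum≡1+n
                                (weight-column-≥ (predecessors∈ {y} sum≡1+n)))
             (layer-sums d (suc n)))
    (All.map (λ {x} sum≡n → ≤-reflexive (trans
               (weight-row {x = x} (layer-unique d (suc n)) (λ i → increment-∈-layer i x sum≡n))
               (cong (d +_) sum≡n)))
             (layer-sums d n))
    where
    predecessors∈ : ∀ {y : Vertex d} → sum y ≡ suc n → ∀ z → suc (sum z) ≡ sum y → z ∈ layer d n
    predecessors∈ sum≡1+n z 1+sum≡ = from ∈-layer⇔ (suc-injective (trans 1+sum≡ sum≡1+n))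

  star-expansion : ∀ {n} {T : List (Vertex d)} → Unique T → All (Sphere (origin d) n) T →
    length T * (d + n) ≤ length (star T n) * suc n
  star-expansion {n} {T} T-unique T⊆Sₙ = expansion-≤ T-unique (star-unique T n)
    (All.tabulate (λ {x} x∈T →
      let sum≡n = to sphere⇔sum (All.lookup T⊆Sₙ x∈T) in
      sum≡n , λ i → from ∈-star⇔
        (from sphere⇔sum (sum-increment-≡ i x sum≡n) , x , x∈T , adj-increment i x)))
    (All.tabulate (λ y∈ → to sphere⇔sum (proj₁ (to ∈-star⇔ y∈))))

proposition3p6 : (d : ℕ) → 1 ≤ d → HomogeneousGrowth d (origin d)
proposition3p6 (suc d) _ = 0 , λ n _ →
  s n , s (suc n) , sphere-card (suc d) n , sphere-card (suc d) (suc n) , layer-nonempty d n ,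
  ratio-≤⇒≤ (s n) (s (suc n)) (layer-expansion {suc d} n) (s≤s (m≤n+m n d)) ,
  λ T T-unique _ T⊆Sₙ → length (star T n) , star-card T n ,
    ratio-≤-trans (s n) (s (suc n)) (length T) (length (star T n))
                  (layer-contraction {suc d} n) (star-expansion T-unique T⊆Sₙ)
  where
  s : ℕ → ℕ
  s n = length (layer (suc d) n)
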